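{- Let $\mathbb{F}$ be a finite field with $n=|\mathbb{F}|$ and $R=M_2(\mathbb{F})$. Let $E=\begin{pmatrix} a & b\\ a(1-a)b^{ -1} & 1-a\end{pmatrix}$ and $E_i=\begin{pmatrix} a_i & b_i\\ a_i(1-a_i)b_i^{ -1} & 1-a_i\end{pmatrix}$ for $i=1,2$, where $a,a_1,a_2\in\mathbb{F}\setminus\{0,1\}$ and $b,b_1,b_2\in\mathbb{F}\setminus\{0\}$. Then \begin{enumerate} \item $EE_1=0$ if and only if $b_1=-(1-a_1)a^{ -1}b$; \item $E_2E=0$ if and only if $b_2=-a_2(1-a)^{ -1}b$. \end{enumerate} Moreover, $\deg(E)=2n-1$ in $G_{Id}(R)$.
   Context: $G_{Id}(R)$ is the graph whose vertices are the nontrivial idempotents of $R=M_2(\mathbb{F})$ (other than the zero and identity matrices), with distinct $h,k$ adjacent iff $hk=0$ or $kh=0$. The matrices of the stated form (with $a\notin\{0,1\}$, $b\neq 0$) are exactly the nontrivial idempotents of $R$ having all entries nonzero-type structure, i.e. those not among $E_{11}$, $E_{22}$ and the idempotents with a zero off-diagonal entry. -}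

module Defs where

open import Level using (0ℓ)
open import Data.Nat using (ℕ)
open import Data.Fin using (Fin)
open import Data.List using (List; []; _∷_; length; filter; concatMap; map)
open import Data.List.Base using (tabulate)
open import Data.Product using (_×_; _,_)
open import Data.Sum using (_⊎_)
open import Relation.Nullary using (¬_; Dec; yes; no)
open import Relation.Nullary.Decidable using (_×-dec_; _⊎-dec_; ¬?)
open import Relation.Binary.Definitions using (DecidableEquality)
open import Relation.Binary.PropositionalEquality using (_≡_; _≢_; refl; cong₂)
open import Algebra.Structures using (IsCommutativeRing)
open import Function.Bundles using (_↔_; Inverse)

-- A finite field, with propositional equality.
--   * commutative ring laws (stdlib IsCommutativeRing over _≡_)
--   * 0 ≠ 1, every nonzero element has a multiplicative inverse
--     (the value of 0⁻¹ is irrelevant/unconstrained)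
--   * decidable equality
--   * finiteness: an explicit bijection Fin size ↔ Carrier, so size = |F|.
record FiniteField : Set₁ where
  infixl 7 _*_
  infixl 6 _+_
  infix  8 -_
  infix  9 _⁻¹
  field
    Carrier : Set
    _+_ _*_ : Carrier → Carrier → Carrier
    -_      : Carrier → Carrier
    0# 1#   : Carrier
    isCommutativeRing : IsCommutativeRing _≡_ _+_ _*_ -_ 0# 1#
    0≢1     : 0# ≢ 1#
    _⁻¹     : Carrier → Carrier
    ⁻¹-inverse : ∀ x → x ≢ 0# → x * x ⁻¹ ≡ 1#
    _≟_     : DecidableEquality Carrier
    size    : ℕ
    enum    : Fin size ↔ Carrier

  _-_ : Carrier → Carrier → Carrier
  x - y = x + (- y)
  infixl 6 _-_

module M2 (F : FiniteField) where
  open FiniteField F public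

  record Mat : Set where
    constructor mat
    field
      m11 m12 m21 m22 : Carrier

  _⊗_ : Mat → Mat → Mat
  mat a b c d ⊗ mat e f g h =
    mat (a * e + b * g) (a * f + b * h) (c * e + d * g) (c * f + d * h)
  infixl 7 _⊗_

  O I : Mat
  O = mat 0# 0# 0# 0#
  I = mat 1# 0# 0# 1#

  _≟M_ : DecidableEquality Mat
  mat a b c d ≟M mat e f g h with a ≟ e | b ≟ f | c ≟ g | d ≟ h
  ... | yes refl | yes refl | yes refl | yes refl = yes refl
  ... | no p | _ | _ | _ = no λ { refl → p refl }
  ... | yes _ | no p | _ | _ = no λ { refl → p refl }
  ... | yes _ | yes _ | no p | _ = no λ { refl → p refl }
  ... | yes _ | yes _ | yes _ | no p = no λ { refl → p refl }

  Emat : Carrier → Carrier → Mat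
  Emat a b = mat a b (a * (1# - a) * b ⁻¹) (1# - a)

  -- vertices of G_Id(R): idempotents other than 0 and I
  IsVertex : Mat → Set
  IsVertex K = (K ⊗ K ≡ K) × (K ≢ O) × (K ≢ I)

  Adj : Mat → Mat → Set
  Adj H K = (H ≢ K) × ((H ⊗ K ≡ O) ⊎ (K ⊗ H ≡ O))

  vertex? : ∀ K → Dec (IsVertex K)
  vertex? K = ((K ⊗ K) ≟M K) ×-dec (¬? (K ≟M O) ×-dec ¬? (K ≟M I))

  adj? : ∀ H K → Dec (Adj H K)
  adj? H K = ¬? (H ≟M K) ×-dec (((H ⊗ K) ≟M O) ⊎-dec ((K ⊗ H) ≟M O))

  elems : List Carrier
  elems = tabulate (Inverse.to enum)

  allMats : List Mat
  allMats = concatMap (λ a → concatMap (λ b → concatMap (λ c → map (mat a b c) elems) elems) elems) elems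

  deg : Mat → ℕ
  deg H = length (filter (λ K → vertex? K ×-dec adj? H K) allMats)

-- Write E = Emat a b as the outer product p qᵀ of the column p = (1, (1-a)b⁻¹) and the
-- row q = (a, b). Then E E′ = (q · p′) p q′ᵀ, so E E′ = 0 exactly when q · p′ = 0, that is
-- a b′ + b (1 - a′) = 0; solving for b′, resp. b, gives (1) and (2).
-- A vertex K with E K = 0 has its columns in the kernel of E, spanned by ker = (1, -a b⁻¹),
-- so K = ker yᵀ; such a matrix has determinant 0, hence is not I, and it is a nonzero
-- idempotent iff y · ker = 1. These y form a line, giving |F| vertices; symmetrically the
-- vertices with K E = 0 are x cokerᵀ with coker · x = 1. The two families share exactly
-- one matrix, and E lies in neither since E E = E ≠ 0, so deg E = 2|F| - 1.

module Submission where

open import Defs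
open import Data.Nat using (_∸_) renaming (_*_ to _*ℕ_)
open import Data.Product using (_×_)
open import Function.Bundles using (_⇔_)
open import Relation.Binary.PropositionalEquality using (_≡_; _≢_)

open import Level using (0ℓ)
open import Data.Nat as ℕ using (ℕ; zero; suc)
import Data.Nat.Properties as ℕ
open import Data.Integer as ℤ using (ℤ; -[1+_]; _⊖_; _◃_; sign; ∣_∣; 0ℤ; 1ℤ)
import Data.Integer.Properties as ℤ
open import Data.Sign as Sign using (Sign)
open import Data.Maybe using (Maybe; just; nothing)
open import Data.Empty using (⊥-elim)
open import Data.List using (List; []; _∷_; length; filter; concatMap; map)
open import Data.List.Properties using (length-tabulate; length-map; filter-≐)
open import Data.List.Membership.Propositional using (_∈_; lose)
open import Data.List.Membership.Propositional.Properties
  using (∈-filter⁺; ∈-filter⁻; ∈-tabulate⁺; ∈-map⁺; ∈-map⁻; ∈-concatMap⁺)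
open import Data.List.Membership.Propositional.Properties.WithK using (unique∧set⇒bag)
open import Data.List.Relation.Binary.BagAndSetEquality using (∼bag⇒↭)
open import Data.List.Relation.Binary.Permutation.Propositional.Properties using (↭-length)
open import Data.List.Relation.Unary.Any using (here; there)
open import Data.List.Relation.Unary.All as All using (All)
import Data.List.Relation.Unary.All.Properties as All
import Data.List.Relation.Unary.AllPairs as AllPairs
import Data.List.Relation.Unary.AllPairs.Properties as AllPairs
open import Data.List.Relation.Unary.Unique.Propositional using (Unique)
import Data.List.Relation.Unary.Unique.Propositional.Properties as Unique
open import Data.Product using (_,_; proj₁; proj₂; ∃-syntax)
open import Data.Sum using (_⊎_; inj₁; inj₂)
open import Function using (_∘_)
open import Function.Bundles using (mk⇔; Equivalence; Inverse; Injection)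
open import Function.Properties.Inverse using (↔⇒↣)
open import Function.Construct.Composition using (_⇔-∘_)
open import Function.Construct.Symmetry using (⇔-sym)
open import Relation.Nullary using (yes; no)
open import Relation.Nullary.Decidable using (_×-dec_; _⊎-dec_)
open import Relation.Unary using (Pred; Decidable)
open import Relation.Binary.PropositionalEquality using (refl; sym; trans; cong; cong₂; subst; module ≡-Reasoning)
open import Algebra.Bundles using (CommutativeRing)
open import Algebra.Solver.Ring.AlmostCommutativeRing using (fromCommutativeRing; _-Raw-AlmostCommutative⟶_)

module _ {A : Set} {P Q : Pred A 0ℓ} (P? : Decidable P) (Q? : Decidable Q) where

  length-filter-⊎+length-filter-× : ∀ xs →
    length (filter (λ x → P? x ⊎-dec Q? x) xs) ℕ.+ length (filter (λ x → P? x ×-dec Q? x) xs)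
      ≡ length (filter P? xs) ℕ.+ length (filter Q? xs)
  length-filter-⊎+length-filter-× [] = refl
  length-filter-⊎+length-filter-× (x ∷ xs) with ih ← length-filter-⊎+length-filter-× xs | P? x | Q? x
  ... | yes _ | yes _ = cong suc (trans (ℕ.+-suc _ _) (trans (cong suc ih) (sym (ℕ.+-suc _ _))))
  ... | yes _ | no  _ = cong suc ih
  ... | no  _ | yes _ = trans (cong suc ih) (sym (ℕ.+-suc _ _))
  ... | no  _ | no  _ = ih

module _ {A : Set} {P : Pred A 0ℓ} (P? : Decidable P) where

  length-filter≡length : ∀ {xs ys} → Unique xs → (∀ x → x ∈ xs) → Unique ys →
    (∀ {x} → P x ⇔ x ∈ ys) → length (filter P? xs) ≡ length ys
  length-filter≡length {xs} xs! xs-complete ys! P⇔∈ =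
    ↭-length (∼bag⇒↭ (unique∧set⇒bag (Unique.filter⁺ P? xs!) ys! (mk⇔
      (λ x∈ → Equivalence.to P⇔∈ (proj₂ (∈-filter⁻ P? {xs = xs} x∈)))
      (λ x∈ → ∈-filter⁺ P? (xs-complete _) (Equivalence.from P⇔∈ x∈)))))

module _ {A B : Set} {f : A → List B} where

  All-concatMap : ∀ {P : Pred B 0ℓ} → (∀ x → All P (f x)) → ∀ xs → All P (concatMap f xs)
  All-concatMap Pf xs = All.concat⁺ (All.map⁺ {xs = xs} (All.universal Pf xs))

  Unique-concatMap : (key : B → A) → (∀ x → All (λ y → key y ≡ x) (f x)) →
    (∀ x → Unique (f x)) → ∀ {xs} → Unique xs → Unique (concatMap f xs)
  Unique-concatMap key key-f f! {xs} xs! = Unique.concat⁺ {xss = map f xs}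
    (All.map⁺ (All.universal f! _))
    (AllPairs.map⁺ {f = f} (AllPairs.map (λ x≢y {v} (v∈fx , v∈fy) →
      x≢y (trans (sym (All.lookup (key-f _) v∈fx)) (All.lookup (key-f _) v∈fy))) xs!))

-- The ring solver decides equality of coefficients by computation, so over an abstract
-- ring it is instantiated with integer coefficients, mapped in by n ↦ n × 1#.
module IntegerCoefficientSolver {c ℓ} (R : CommutativeRing c ℓ) where
  open CommutativeRing R renaming (refl to ≈-refl; sym to ≈-sym; trans to ≈-trans)
  open import Algebra.Properties.Ring ring using (-‿involutive; -0#≈0#; -1*x≈-x; -‿distribˡ-*; -‿distribʳ-*)
  open import Algebra.Properties.AbelianGroup +-abelianGroup using (⁻¹-∙-comm)
  open import Algebra.Properties.Semiring.Mult.TCOptimised semiring using (1+×; ×-homo-+; ×1-homo-*) renaming (_×_ to _×ₙ_)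
  open import Relation.Binary.Reasoning.Setoid setoid
  import Algebra.Solver.CommutativeMonoid +-commutativeMonoid as +-Solver
  import Algebra.Solver.CommutativeMonoid *-commutativeMonoid as *-Solver

  ⟦_⟧ℤ : ℤ → Carrier
  ⟦ ℤ.+ n ⟧ℤ = n ×ₙ 1#
  ⟦ -[1+ n ] ⟧ℤ = - (suc n ×ₙ 1#)

  private
    [1+x]-[1+y]≈x-y : ∀ x y → (1# + x) - (1# + y) ≈ x - y
    [1+x]-[1+y]≈x-y x y = begin
      (1# + x) - (1# + y)      ≈⟨ +-congˡ (⁻¹-∙-comm 1# y) ⟨
      (1# + x) + (- 1# + - y)  ≈⟨ +-Solver.solve 4 (λ o x m y → (o ⊕ x) ⊕ (m ⊕ y) ⊜ (o ⊕ m) ⊕ (x ⊕ y)) ≈-refl 1# x (- 1#) (- y) ⟩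
      (1# - 1#) + (x - y)      ≈⟨ +-congʳ (-‿inverseʳ 1#) ⟩
      0# + (x - y)             ≈⟨ +-identityˡ _ ⟩
      x - y                    ∎
      where open +-Solver using (_⊕_; _⊜_)

  ⊖-homo : ∀ m n → ⟦ m ⊖ n ⟧ℤ ≈ m ×ₙ 1# - n ×ₙ 1#
  ⊖-homo m zero = ≈-sym (≈-trans (+-congˡ -0#≈0#) (+-identityʳ _))
  ⊖-homo zero (suc n) = ≈-sym (+-identityˡ _)
  ⊖-homo (suc m) (suc n) = begin
    ⟦ suc m ⊖ suc n ⟧ℤ                ≡⟨ cong ⟦_⟧ℤ (ℤ.[1+m]⊖[1+n]≡m⊖n m n) ⟩
    ⟦ m ⊖ n ⟧ℤ                        ≈⟨ ⊖-homo m n ⟩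
    m ×ₙ 1# - n ×ₙ 1#                   ≈⟨ [1+x]-[1+y]≈x-y _ _ ⟨
    (1# + m ×ₙ 1#) - (1# + n ×ₙ 1#)     ≈⟨ +-cong (1+× m 1#) (-‿cong (1+× n 1#)) ⟨
    suc m ×ₙ 1# - suc n ×ₙ 1#           ∎

  +-homo : ∀ i j → ⟦ i ℤ.+ j ⟧ℤ ≈ ⟦ i ⟧ℤ + ⟦ j ⟧ℤ
  +-homo (ℤ.+ m) (ℤ.+ n) = ×-homo-+ 1# m n
  +-homo (ℤ.+ m) -[1+ n ] = ⊖-homo m (suc n)
  +-homo -[1+ m ] (ℤ.+ n) = ≈-trans (⊖-homo n (suc m)) (+-comm _ _)
  +-homo -[1+ m ] -[1+ n ] = begin
    - (suc (suc (m ℕ.+ n)) ×ₙ 1#)      ≡⟨ cong (λ k → - (suc k ×ₙ 1#)) (ℕ.+-suc m n) ⟨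
    - ((suc m ℕ.+ suc n) ×ₙ 1#)        ≈⟨ -‿cong (×-homo-+ 1# (suc m) (suc n)) ⟩
    - (suc m ×ₙ 1# + suc n ×ₙ 1#)      ≈⟨ ⁻¹-∙-comm _ _ ⟨
    - (suc m ×ₙ 1#) + - (suc n ×ₙ 1#)  ∎

  -‿homo : ∀ i → ⟦ ℤ.- i ⟧ℤ ≈ - ⟦ i ⟧ℤ
  -‿homo (ℤ.+ zero) = ≈-sym -0#≈0#
  -‿homo (ℤ.+ suc n) = ≈-refl
  -‿homo -[1+ n ] = ≈-sym (-‿involutive _)

  ⟦_⟧ₛ : Sign → Carrier
  ⟦ Sign.+ ⟧ₛ = 1#
  ⟦ Sign.- ⟧ₛ = - 1#

  ◃-homo : ∀ s n → ⟦ s ◃ n ⟧ℤ ≈ ⟦ s ⟧ₛ * (n ×ₙ 1#)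
  ◃-homo s zero = ≈-sym (zeroʳ _)
  ◃-homo Sign.+ (suc n) = ≈-sym (*-identityˡ _)
  ◃-homo Sign.- (suc n) = ≈-sym (-1*x≈-x _)

  sign-homo : ∀ s t → ⟦ s Sign.* t ⟧ₛ ≈ ⟦ s ⟧ₛ * ⟦ t ⟧ₛ
  sign-homo Sign.+ t = ≈-sym (*-identityˡ _)
  sign-homo Sign.- Sign.+ = ≈-sym (*-identityʳ _)
  sign-homo Sign.- Sign.- = ≈-sym (≈-trans (-1*x≈-x _) (-‿involutive 1#))

  *-homo : ∀ i j → ⟦ i ℤ.* j ⟧ℤ ≈ ⟦ i ⟧ℤ * ⟦ j ⟧ℤ
  *-homo i j = begin
    ⟦ (sign i Sign.* sign j) ◃ (∣ i ∣ ℕ.* ∣ j ∣) ⟧ℤ                    ≈⟨ ◃-homo (sign i Sign.* sign j) (∣ i ∣ ℕ.* ∣ j ∣) ⟩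
    ⟦ sign i Sign.* sign j ⟧ₛ * ((∣ i ∣ ℕ.* ∣ j ∣) ×ₙ 1#)             ≈⟨ *-cong (sign-homo (sign i) (sign j)) (×1-homo-* ∣ i ∣ ∣ j ∣) ⟩
    (⟦ sign i ⟧ₛ * ⟦ sign j ⟧ₛ) * ((∣ i ∣ ×ₙ 1#) * (∣ j ∣ ×ₙ 1#))     ≈⟨ *-Solver.solve 4 (λ s t x y → (s ⊕ t) ⊕ (x ⊕ y) ⊜ (s ⊕ x) ⊕ (t ⊕ y)) ≈-refl _ _ _ _ ⟩
    (⟦ sign i ⟧ₛ * (∣ i ∣ ×ₙ 1#)) * (⟦ sign j ⟧ₛ * (∣ j ∣ ×ₙ 1#))     ≈⟨ *-cong (◃-homo (sign i) ∣ i ∣) (◃-homo (sign j) ∣ j ∣) ⟨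
    ⟦ sign i ◃ ∣ i ∣ ⟧ℤ * ⟦ sign j ◃ ∣ j ∣ ⟧ℤ                           ≡⟨ cong₂ (λ i′ j′ → ⟦ i′ ⟧ℤ * ⟦ j′ ⟧ℤ) (ℤ.◃-inverse i) (ℤ.◃-inverse j) ⟩
    ⟦ i ⟧ℤ * ⟦ j ⟧ℤ                                                   ∎
    where open *-Solver using (_⊕_; _⊜_)

  homomorphism : ℤ.+-*-rawRing -Raw-AlmostCommutative⟶ fromCommutativeRing R
  homomorphism = record
    { ⟦_⟧ = ⟦_⟧ℤ ; +-homo = +-homo ; *-homo = *-homo ; -‿homo = -‿homo
    ; 0-homo = ≈-refl ; 1-homo = ≈-refl }

  ⟦⟧ℤ-≟ : ∀ i j → Maybe (⟦ i ⟧ℤ ≈ ⟦ j ⟧ℤ)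
  ⟦⟧ℤ-≟ i j with i ℤ.≟ j
  ... | yes refl = just ≈-refl
  ... | no _ = nothing

  open import Algebra.Solver.Ring ℤ.+-*-rawRing (fromCommutativeRing R) homomorphism ⟦⟧ℤ-≟ public

module _ (F : FiniteField) where
  open M2 F
  open Mat
  open ≡-Reasoning

  commutativeRing : CommutativeRing 0ℓ 0ℓ
  commutativeRing = record { isCommutativeRing = isCommutativeRing }

  open CommutativeRing commutativeRing using (+-abelianGroup; *-comm; zeroˡ; zeroʳ; *-identityˡ; *-identityʳ; -‿inverseˡ; -‿inverseʳ)
  open import Algebra.Properties.AbelianGroup +-abelianGroup using (inverseˡ-unique; x∙y⁻¹≈ε⇒x≈y)
  open IntegerCoefficientSolver commutativeRing using (solve; _:=_; con; _:+_; _:*_; _:-_; :-_)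

  ⁻¹-inverseˡ : ∀ x → x ≢ 0# → x ⁻¹ * x ≡ 1#
  ⁻¹-inverseˡ x x≢0 = trans (*-comm _ _) (⁻¹-inverse x x≢0)

  u⁻¹*[u*y]≡y : ∀ {u} y → u ≢ 0# → u ⁻¹ * (u * y) ≡ y
  u⁻¹*[u*y]≡y {u} y u≢0 = begin
    u ⁻¹ * (u * y)  ≡⟨ solve 3 (λ v u y → v :* (u :* y) := (v :* u) :* y) refl (u ⁻¹) u y ⟩
    u ⁻¹ * u * y    ≡⟨ cong (_* y) (⁻¹-inverseˡ u u≢0) ⟩
    1# * y          ≡⟨ *-identityˡ y ⟩
    y               ∎

  u*y≡0⇒y≡0 : ∀ {u y} → u ≢ 0# → u * y ≡ 0# → y ≡ 0#
  u*y≡0⇒y≡0 {u} {y} u≢0 uy≡0 = begin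
    y               ≡⟨ u⁻¹*[u*y]≡y y u≢0 ⟨
    u ⁻¹ * (u * y)  ≡⟨ cong (u ⁻¹ *_) uy≡0 ⟩
    u ⁻¹ * 0#       ≡⟨ zeroʳ _ ⟩
    0#              ∎

  x≡0⇔x*u≡0 : ∀ {u x} → u ≢ 0# → x ≡ 0# ⇔ x * u ≡ 0#
  x≡0⇔x*u≡0 {u} u≢0 = mk⇔ (λ { refl → zeroˡ u }) (λ xu≡0 → u*y≡0⇒y≡0 u≢0 (trans (*-comm _ _) xu≡0))

  x+y≡0⇔x≡-y : ∀ {x y} → x + y ≡ 0# ⇔ x ≡ - y
  x+y≡0⇔x≡-y {x} {y} = mk⇔ (inverseˡ-unique x y) (λ { refl → -‿inverseˡ y })

  1-x≢0 : ∀ {x} → x ≢ 1# → 1# - x ≢ 0#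
  1-x≢0 {x} x≢1 1-x≡0 = x≢1 (sym (x∙y⁻¹≈ε⇒x≈y 1# x 1-x≡0))

  u*y+c≡0⇔y≡-[u⁻¹*c] : ∀ {u y c} → u ≢ 0# → u * y + c ≡ 0# ⇔ y ≡ - (u ⁻¹ * c)
  u*y+c≡0⇔y≡-[u⁻¹*c] {u} {y} {c} u≢0 = mk⇔ to from
    where
    to : u * y + c ≡ 0# → y ≡ - (u ⁻¹ * c)
    to eq = begin
      y               ≡⟨ u⁻¹*[u*y]≡y y u≢0 ⟨
      u ⁻¹ * (u * y)  ≡⟨ cong (u ⁻¹ *_) (Equivalence.to x+y≡0⇔x≡-y eq) ⟩
      u ⁻¹ * - c      ≡⟨ solve 2 (λ v c → v :* (:- c) := :- (v :* c)) refl (u ⁻¹) c ⟩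
      - (u ⁻¹ * c)    ∎
    from : y ≡ - (u ⁻¹ * c) → u * y + c ≡ 0#
    from refl = begin
      u * - (u ⁻¹ * c) + c  ≡⟨ solve 3 (λ u v c → u :* (:- (v :* c)) :+ c := c :- (u :* v) :* c) refl u (u ⁻¹) c ⟩
      c - u * u ⁻¹ * c      ≡⟨ cong (λ w → c - w * c) (⁻¹-inverse u u≢0) ⟩
      c - 1# * c            ≡⟨ solve 1 (λ c → c :- con 1ℤ :* c := con 0ℤ) refl c ⟩
      0#                    ∎

  mat-cong : ∀ {p q r s p′ q′ r′ s′} → p ≡ p′ → q ≡ q′ → r ≡ r′ → s ≡ s′ → mat p q r s ≡ mat p′ q′ r′ s′
  mat-cong refl refl refl refl = refl

  infixl 7 _•_
  _•_ : Carrier → Mat → Mat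
  s • mat p q r t = mat (s * p) (s * q) (s * r) (s * t)

  _·_ : Carrier × Carrier → Carrier × Carrier → Carrier
  (x₁ , x₂) · (y₁ , y₂) = x₁ * y₁ + x₂ * y₂

  outer : Carrier × Carrier → Carrier × Carrier → Mat
  outer (x₁ , x₂) (y₁ , y₂) = mat (x₁ * y₁) (x₁ * y₂) (x₂ * y₁) (x₂ * y₂)

  trace det : Mat → Carrier
  trace (mat p _ _ s) = p + s
  det (mat p q r s) = p * s - q * r

  0•M≡O : ∀ M → 0# • M ≡ O
  0•M≡O (mat p q r s) = mat-cong (zeroˡ p) (zeroˡ q) (zeroˡ r) (zeroˡ s)

  1•M≡M : ∀ M → 1# • M ≡ M
  1•M≡M (mat p q r s) = mat-cong (*-identityˡ p) (*-identityˡ q) (*-identityˡ r) (*-identityˡ s)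

  s•M≡O⇒M≡O : ∀ {s} M → s ≢ 0# → s • M ≡ O → M ≡ O
  s•M≡O⇒M≡O {s} (mat p q r t) s≢0 eq = mat-cong (cancel (cong m11 eq)) (cancel (cong m12 eq)) (cancel (cong m21 eq)) (cancel (cong m22 eq))
    where
    cancel : ∀ {m} → s * m ≡ 0# → m ≡ 0#
    cancel = u*y≡0⇒y≡0 s≢0

  s•M≡M⇒s≡1 : ∀ {s} M → M ≢ O → s • M ≡ M → s ≡ 1#
  s•M≡M⇒s≡1 {s} M@(mat p q r t) M≢O eq with s ≟ 1#
  ... | yes s≡1 = s≡1
  ... | no s≢1 = ⊥-elim (M≢O (s•M≡O⇒M≡O M (s≢1 ∘ x∙y⁻¹≈ε⇒x≈y s 1#)
         (mat-cong (fixed (cong m11 eq)) (fixed (cong m12 eq)) (fixed (cong m21 eq)) (fixed (cong m22 eq)))))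
    where
    fixed : ∀ {m} → s * m ≡ m → (s - 1#) * m ≡ 0#
    fixed {m} sm≡m = begin
      (s - 1#) * m  ≡⟨ solve 2 (λ s m → (s :- con 1ℤ) :* m := s :* m :- m) refl s m ⟩
      s * m - m     ≡⟨ cong (_- m) sm≡m ⟩
      m - m         ≡⟨ -‿inverseʳ m ⟩
      0#            ∎

  outer⊗outer : ∀ x y z w → outer x y ⊗ outer z w ≡ (y · z) • outer x w
  outer⊗outer (x₁ , x₂) (y₁ , y₂) (z₁ , z₂) (w₁ , w₂) =
    mat-cong (entry x₁ w₁) (entry x₁ w₂) (entry x₂ w₁) (entry x₂ w₂)
    where
    entry : ∀ xᵢ wⱼ → xᵢ * y₁ * (z₁ * wⱼ) + xᵢ * y₂ * (z₂ * wⱼ) ≡ (y₁ * z₁ + y₂ * z₂) * (xᵢ * wⱼ)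
    entry = solve 6 (λ y₁ y₂ z₁ z₂ xᵢ wⱼ → xᵢ :* y₁ :* (z₁ :* wⱼ) :+ xᵢ :* y₂ :* (z₂ :* wⱼ) := (y₁ :* z₁ :+ y₂ :* z₂) :* (xᵢ :* wⱼ)) refl y₁ y₂ z₁ z₂

  outer⊗outer≡O : ∀ x y z w → y · z ≡ 0# → outer x y ⊗ outer z w ≡ O
  outer⊗outer≡O x y z w y·z≡0 = begin
    outer x y ⊗ outer z w  ≡⟨ outer⊗outer x y z w ⟩
    (y · z) • outer x w    ≡⟨ cong (_• outer x w) y·z≡0 ⟩
    0# • outer x w         ≡⟨ 0•M≡O (outer x w) ⟩
    O                      ∎

  trace-outer : ∀ x y → trace (outer x y) ≡ y · x
  trace-outer (x₁ , x₂) (y₁ , y₂) = solve 4 (λ x₁ x₂ y₁ y₂ → x₁ :* y₁ :+ x₂ :* y₂ := y₁ :* x₁ :+ y₂ :* x₂) refl x₁ x₂ y₁ y₂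

  det-outer : ∀ x y → det (outer x y) ≡ 0#
  det-outer (x₁ , x₂) (y₁ , y₂) = solve 4 (λ x₁ x₂ y₁ y₂ → x₁ :* y₁ :* (x₂ :* y₂) :- x₁ :* y₂ :* (x₂ :* y₁) := con 0ℤ) refl x₁ x₂ y₁ y₂

  det-I : det I ≡ 1#
  det-I = solve 0 (con 1ℤ :* con 1ℤ :- con 0ℤ :* con 0ℤ := con 1ℤ) refl

  trace-O : trace O ≡ 0#
  trace-O = solve 0 (con 0ℤ :+ con 0ℤ := con 0ℤ) refl

  outer≢O : ∀ x y → y · x ≡ 1# → outer x y ≢ O
  outer≢O x y y·x≡1 outer≡O = 0≢1 (begin
    0#                 ≡⟨ trace-O ⟨
    trace O            ≡⟨ cong trace outer≡O ⟨
    trace (outer x y)  ≡⟨ trace-outer x y ⟩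
    y · x              ≡⟨ y·x≡1 ⟩
    1#                 ∎)

  outer≢I : ∀ x y → outer x y ≢ I
  outer≢I x y outer≡I = 0≢1 (begin
    0#               ≡⟨ det-outer x y ⟨
    det (outer x y)  ≡⟨ cong det outer≡I ⟩
    det I            ≡⟨ det-I ⟩
    1#               ∎)

  isVertex-outer⇔ : ∀ x y → IsVertex (outer x y) ⇔ y · x ≡ 1#
  isVertex-outer⇔ x y = mk⇔ to from
    where
    to : IsVertex (outer x y) → y · x ≡ 1#
    to (idem , outer≢O′ , _) = s•M≡M⇒s≡1 (outer x y) outer≢O′ (trans (sym (outer⊗outer x y x y)) idem)
    from : y · x ≡ 1# → IsVertex (outer x y)
    from y·x≡1 = trans (outer⊗outer x y x y) (trans (cong (_• outer x y) y·x≡1) (1•M≡M (outer x y))) , outer≢O x y y·x≡1 , outer≢I x y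

  Emat-column : Carrier → Carrier → Carrier × Carrier
  Emat-column a b = (1# , (1# - a) * b ⁻¹)

  Emat≡outer : ∀ {a b} → b ≢ 0# → Emat a b ≡ outer (Emat-column a b) (a , b)
  Emat≡outer {a} {b} b≢0 = mat-cong (sym (*-identityˡ a)) (sym (*-identityˡ b))
    (solve 2 (λ a v → a :* (con 1ℤ :- a) :* v := (con 1ℤ :- a) :* v :* a) refl a (b ⁻¹))
    (begin
      1# - a                 ≡⟨ *-identityʳ _ ⟨
      (1# - a) * 1#          ≡⟨ cong ((1# - a) *_) (⁻¹-inverseˡ b b≢0) ⟨
      (1# - a) * (b ⁻¹ * b)  ≡⟨ solve 3 (λ c v b → c :* (v :* b) := c :* v :* b) refl (1# - a) (b ⁻¹) b ⟩
      (1# - a) * b ⁻¹ * b    ∎)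

  Emat-isVertex : ∀ {a b} → b ≢ 0# → IsVertex (Emat a b)
  Emat-isVertex {a} {b} b≢0 = subst IsVertex (sym (Emat≡outer b≢0))
    (Equivalence.from (isVertex-outer⇔ (Emat-column a b) (a , b)) (begin
      a * 1# + b * ((1# - a) * b ⁻¹)  ≡⟨ solve 3 (λ a b v → a :* con 1ℤ :+ b :* ((con 1ℤ :- a) :* v) := a :+ (con 1ℤ :- a) :* (b :* v)) refl a b (b ⁻¹) ⟩
      a + (1# - a) * (b * b ⁻¹)       ≡⟨ cong (λ u → a + (1# - a) * u) (⁻¹-inverse b b≢0) ⟩
      a + (1# - a) * 1#               ≡⟨ solve 1 (λ a → a :+ (con 1ℤ :- a) :* con 1ℤ := con 1ℤ) refl a ⟩
      1#                              ∎))

  Emat⊗Emat≡O⇔ : ∀ {a b a′ b′} → b ≢ 0# → b′ ≢ 0# →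
    Emat a b ⊗ Emat a′ b′ ≡ O ⇔ a * b′ + b * (1# - a′) ≡ 0#
  Emat⊗Emat≡O⇔ {a} {b} {a′} {b′} b≢0 b′≢0 = mk⇔ (cong m12) λ m12≡0 → begin
    Emat a b ⊗ Emat a′ b′                                      ≡⟨ cong₂ _⊗_ (Emat≡outer b≢0) (Emat≡outer b′≢0) ⟩
    outer (Emat-column a b) (a , b) ⊗ outer (Emat-column a′ b′) (a′ , b′)
      ≡⟨ outer⊗outer≡O (Emat-column a b) (a , b) (Emat-column a′ b′) (a′ , b′) (Equivalence.from (x≡0⇔x*u≡0 b′≢0) (trans dot*b′ m12≡0)) ⟩
    O                                                          ∎
    where
    dot*b′ : ((a , b) · Emat-column a′ b′) * b′ ≡ a * b′ + b * (1# - a′)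
    dot*b′ = begin
      (a * 1# + b * ((1# - a′) * b′ ⁻¹)) * b′  ≡⟨ solve 5 (λ a b c d v → (a :* con 1ℤ :+ b :* (c :* v)) :* d := a :* d :+ b :* c :* (v :* d)) refl a b (1# - a′) b′ (b′ ⁻¹) ⟩
      a * b′ + b * (1# - a′) * (b′ ⁻¹ * b′)    ≡⟨ cong (λ u → a * b′ + b * (1# - a′) * u) (⁻¹-inverseˡ b′ b′≢0) ⟩
      a * b′ + b * (1# - a′) * 1#              ≡⟨ cong ((a * b′) +_) (*-identityʳ _) ⟩
      a * b′ + b * (1# - a′)                   ∎

  Emat⊗Emat≡O⇔b′≡ : ∀ {a b a′ b′} → a ≢ 0# → b ≢ 0# → b′ ≢ 0# →
    Emat a b ⊗ Emat a′ b′ ≡ O ⇔ b′ ≡ - ((1# - a′) * a ⁻¹ * b)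
  Emat⊗Emat≡O⇔b′≡ {a} {b} {a′} {b′} a≢0 b≢0 b′≢0 =
    mk⇔ (λ e → trans e (cong -_ reorder)) (λ e → trans e (cong -_ (sym reorder)))
      ⇔-∘ (u*y+c≡0⇔y≡-[u⁻¹*c] a≢0 ⇔-∘ Emat⊗Emat≡O⇔ b≢0 b′≢0)
    where
    reorder : a ⁻¹ * (b * (1# - a′)) ≡ (1# - a′) * a ⁻¹ * b
    reorder = solve 3 (λ v b c → v :* (b :* c) := c :* v :* b) refl (a ⁻¹) b (1# - a′)

  Emat⊗Emat≡O⇔b≡ : ∀ {a b a′ b′} → 1# - a′ ≢ 0# → b ≢ 0# → b′ ≢ 0# →
    Emat a b ⊗ Emat a′ b′ ≡ O ⇔ b ≡ - (a * (1# - a′) ⁻¹ * b′)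
  Emat⊗Emat≡O⇔b≡ {a} {b} {a′} {b′} 1-a′≢0 b≢0 b′≢0 =
    mk⇔ (λ e → trans e (cong -_ reorder)) (λ e → trans e (cong -_ (sym reorder)))
      ⇔-∘ (u*y+c≡0⇔y≡-[u⁻¹*c] 1-a′≢0
      ⇔-∘ (mk⇔ (trans rearrange) (trans (sym rearrange))
      ⇔-∘ Emat⊗Emat≡O⇔ b≢0 b′≢0))
    where
    reorder : (1# - a′) ⁻¹ * (a * b′) ≡ a * (1# - a′) ⁻¹ * b′
    reorder = solve 3 (λ v a b′ → v :* (a :* b′) := a :* v :* b′) refl ((1# - a′) ⁻¹) a b′
    rearrange : (1# - a′) * b + a * b′ ≡ a * b′ + b * (1# - a′)
    rearrange = solve 4 (λ c b a b′ → c :* b :+ a :* b′ := a :* b′ :+ b :* c) refl (1# - a′) b a b′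

  elems-complete : ∀ x → x ∈ elems
  elems-complete x = subst (_∈ elems) (Inverse.strictlyInverseˡ enum x) (∈-tabulate⁺ (Inverse.from enum x))

  elems-unique : Unique elems
  elems-unique = Unique.tabulate⁺ (Injection.injective (↔⇒↣ enum))

  length-elems : length elems ≡ size
  length-elems = length-tabulate (Inverse.to enum)

  allMats-complete : ∀ K → K ∈ allMats
  allMats-complete (mat p q r s) =
    ∈-concatMap⁺′ (elems-complete p) (∈-concatMap⁺′ (elems-complete q) (∈-concatMap⁺′ (elems-complete r) (∈-map⁺ (mat p q r) (elems-complete s))))
    where
    ∈-concatMap⁺′ : ∀ {A B : Set} {f : A → List B} {x xs y} → x ∈ xs → y ∈ f x → y ∈ concatMap f xs
    ∈-concatMap⁺′ {f = f} x∈ y∈ = ∈-concatMap⁺ f (lose x∈ y∈)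

  allMats-unique : Unique allMats
  allMats-unique =
    Unique-concatMap m11 (λ p → All-concatMap (λ q → All-concatMap (λ r → keyed (mat p q r) (λ _ → refl)) elems) elems)
      (λ p → Unique-concatMap m12 (λ q → All-concatMap (λ r → keyed (mat p q r) (λ _ → refl)) elems)
        (λ q → Unique-concatMap m21 (λ r → keyed (mat p q r) (λ _ → refl))
          (λ r → Unique.map⁺ (cong m22) elems-unique) elems-unique) elems-unique) elems-unique
    where
    keyed : ∀ {key : Mat → Carrier} {k} (f : Carrier → Mat) → (∀ s → key (f s) ≡ k) → All (λ K → key K ≡ k) (map f elems)
    keyed f eq = All.map⁺ (All.universal eq elems)

  ∈-map-elems⇔ : ∀ {B : Set} (h : Carrier → B) {y} → y ∈ map h elems ⇔ (∃[ t ] y ≡ h t)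
  ∈-map-elems⇔ h = mk⇔ (λ y∈ → let t , _ , y≡ht = ∈-map⁻ h y∈ in t , y≡ht)
                      (λ { (t , refl) → ∈-map⁺ h (elems-complete t) })

  length-filter-allMats≡size : ∀ {P : Mat → Set} (P? : Decidable P) (h : Carrier → Mat) →
    (∀ {s t} → h s ≡ h t → s ≡ t) → (∀ {K} → P K ⇔ (∃[ t ] K ≡ h t)) →
    length (filter P? allMats) ≡ size
  length-filter-allMats≡size P? h h-injective P⇔ = begin
    length (filter P? allMats)  ≡⟨ length-filter≡length P? allMats-unique allMats-complete
                                     (Unique.map⁺ h-injective elems-unique) (⇔-sym (∈-map-elems⇔ h) ⇔-∘ P⇔) ⟩
    length (map h elems)        ≡⟨ length-map h elems ⟩
    length elems                ≡⟨ length-elems ⟩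
    size                        ∎

  module Degree {a b : Carrier} (b≢0 : b ≢ 0#) where

    E : Mat
    E = Emat a b

    ker coker : Carrier × Carrier
    ker = (1# , - (a * b ⁻¹))
    coker = (- ((1# - a) * b ⁻¹) , 1#)

    E≡outer : E ≡ outer (Emat-column a b) (a , b)
    E≡outer = Emat≡outer b≢0

    E⊗outer-ker : ∀ y → E ⊗ outer ker y ≡ O
    E⊗outer-ker y = trans (cong (_⊗ outer ker y) E≡outer) (outer⊗outer≡O (Emat-column a b) (a , b) ker y (begin
      a * 1# + b * - (a * b ⁻¹)  ≡⟨ solve 3 (λ a b v → a :* con 1ℤ :+ b :* (:- (a :* v)) := a :- a :* (b :* v)) refl a b (b ⁻¹) ⟩
      a - a * (b * b ⁻¹)         ≡⟨ cong (λ u → a - a * u) (⁻¹-inverse b b≢0) ⟩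
      a - a * 1#                 ≡⟨ solve 1 (λ a → a :- a :* con 1ℤ := con 0ℤ) refl a ⟩
      0#                         ∎))

    outer-coker⊗E : ∀ x → outer x coker ⊗ E ≡ O
    outer-coker⊗E x = trans (cong (outer x coker ⊗_) E≡outer) (outer⊗outer≡O x coker (Emat-column a b) (a , b)
      (solve 1 (λ c → :- c :* con 1ℤ :+ con 1ℤ :* c := con 0ℤ) refl ((1# - a) * b ⁻¹)))

    E⊗K≡O⇒ : ∀ K → E ⊗ K ≡ O → K ≡ outer ker (m11 K , m12 K)
    E⊗K≡O⇒ (mat _ _ _ _) eq =
      mat-cong (sym (*-identityˡ _)) (sym (*-identityˡ _)) (solve-column (cong m11 eq)) (solve-column (cong m12 eq))
      where
      solve-column : ∀ {x y} → a * x + b * y ≡ 0# → y ≡ - (a * b ⁻¹) * x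
      solve-column {x} {y} ax+by≡0 = begin
        y                   ≡⟨ Equivalence.to (u*y+c≡0⇔y≡-[u⁻¹*c] b≢0) (trans (solve 4 (λ a b x y → b :* y :+ a :* x := a :* x :+ b :* y) refl a b x y) ax+by≡0) ⟩
        - (b ⁻¹ * (a * x))  ≡⟨ solve 3 (λ a v x → :- (v :* (a :* x)) := :- (a :* v) :* x) refl a (b ⁻¹) x ⟩
        - (a * b ⁻¹) * x    ∎

    K⊗E≡O⇒ : ∀ K → K ⊗ E ≡ O → K ≡ outer (m12 K , m22 K) coker
    K⊗E≡O⇒ (mat _ _ _ _) eq =
      mat-cong (solve-row (cong m12 eq)) (sym (*-identityʳ _)) (solve-row (cong m22 eq)) (sym (*-identityʳ _))
      where
      solve-row : ∀ {x y} → x * b + y * (1# - a) ≡ 0# → x ≡ y * - ((1# - a) * b ⁻¹)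
      solve-row {x} {y} xb+yc≡0 = begin
        x                         ≡⟨ Equivalence.to (u*y+c≡0⇔y≡-[u⁻¹*c] b≢0) (trans (solve 4 (λ b c x y → b :* x :+ y :* c := x :* b :+ y :* c) refl b (1# - a) x y) xb+yc≡0) ⟩
        - (b ⁻¹ * (y * (1# - a))) ≡⟨ solve 3 (λ v c y → :- (v :* (y :* c)) := y :* (:- (c :* v))) refl (b ⁻¹) (1# - a) y ⟩
        y * - ((1# - a) * b ⁻¹)   ∎

    rightAnn leftAnn : Carrier → Mat
    rightAnn t = outer ker (1# + a * b ⁻¹ * t , t)
    leftAnn t = outer (t , 1# + (1# - a) * b ⁻¹ * t) coker

    RightAnnihilator LeftAnnihilator : Mat → Set
    RightAnnihilator K = IsVertex K × E ⊗ K ≡ O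
    LeftAnnihilator K = IsVertex K × K ⊗ E ≡ O

    rightAnnihilator? : Decidable RightAnnihilator
    rightAnnihilator? K = vertex? K ×-dec ((E ⊗ K) ≟M O)

    leftAnnihilator? : Decidable LeftAnnihilator
    leftAnnihilator? K = vertex? K ×-dec ((K ⊗ E) ≟M O)

    rightAnnihilator⇔ : ∀ {K} → RightAnnihilator K ⇔ (∃[ t ] K ≡ rightAnn t)
    rightAnnihilator⇔ {K} = mk⇔ to from
      where
      from : ∃[ t ] K ≡ rightAnn t → RightAnnihilator K
      from (t , refl) = Equivalence.from (isVertex-outer⇔ ker (1# + a * b ⁻¹ * t , t)) dot , E⊗outer-ker (1# + a * b ⁻¹ * t , t)
        where
        dot : (1# + a * b ⁻¹ * t) * 1# + t * - (a * b ⁻¹) ≡ 1#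
        dot = solve 3 (λ a v t → (con 1ℤ :+ a :* v :* t) :* con 1ℤ :+ t :* (:- (a :* v)) := con 1ℤ) refl a (b ⁻¹) t
      to : RightAnnihilator K → ∃[ t ] K ≡ rightAnn t
      to (K-vertex , E⊗K≡O) = m12 K , trans K≡ (cong (λ s → outer ker (s , m12 K)) m11≡)
        where
        K≡ : K ≡ outer ker (m11 K , m12 K)
        K≡ = E⊗K≡O⇒ K E⊗K≡O
        m11≡ : m11 K ≡ 1# + a * b ⁻¹ * m12 K
        m11≡ = begin
          m11 K                                                                ≡⟨ solve 4 (λ x y a v → x := (x :* con 1ℤ :+ y :* (:- (a :* v))) :+ a :* v :* y) refl (m11 K) (m12 K) a (b ⁻¹) ⟩
          (m11 K * 1# + m12 K * - (a * b ⁻¹)) + a * b ⁻¹ * m12 K             ≡⟨ cong (_+ a * b ⁻¹ * m12 K) (Equivalence.to (isVertex-outer⇔ ker (m11 K , m12 K)) (subst IsVertex K≡ K-vertex)) ⟩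
          1# + a * b ⁻¹ * m12 K                                                ∎

    leftAnnihilator⇔ : ∀ {K} → LeftAnnihilator K ⇔ (∃[ t ] K ≡ leftAnn t)
    leftAnnihilator⇔ {K} = mk⇔ to from
      where
      from : ∃[ t ] K ≡ leftAnn t → LeftAnnihilator K
      from (t , refl) = Equivalence.from (isVertex-outer⇔ (t , 1# + (1# - a) * b ⁻¹ * t) coker) dot , outer-coker⊗E (t , 1# + (1# - a) * b ⁻¹ * t)
        where
        dot : - ((1# - a) * b ⁻¹) * t + 1# * (1# + (1# - a) * b ⁻¹ * t) ≡ 1#
        dot = solve 2 (λ c t → :- c :* t :+ con 1ℤ :* (con 1ℤ :+ c :* t) := con 1ℤ) refl ((1# - a) * b ⁻¹) t
      to : LeftAnnihilator K → ∃[ t ] K ≡ leftAnn t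
      to (K-vertex , K⊗E≡O) = m12 K , trans K≡ (cong (λ s → outer (m12 K , s) coker) m22≡)
        where
        K≡ : K ≡ outer (m12 K , m22 K) coker
        K≡ = K⊗E≡O⇒ K K⊗E≡O
        m22≡ : m22 K ≡ 1# + (1# - a) * b ⁻¹ * m12 K
        m22≡ = begin
          m22 K                                                            ≡⟨ solve 3 (λ x y c → y := (:- c :* x :+ con 1ℤ :* y) :+ c :* x) refl (m12 K) (m22 K) ((1# - a) * b ⁻¹) ⟩
          (- ((1# - a) * b ⁻¹) * m12 K + 1# * m22 K) + (1# - a) * b ⁻¹ * m12 K  ≡⟨ cong (_+ (1# - a) * b ⁻¹ * m12 K) (Equivalence.to (isVertex-outer⇔ (m12 K , m22 K) coker) (subst IsVertex K≡ K-vertex)) ⟩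
          1# + (1# - a) * b ⁻¹ * m12 K                                      ∎

    rightAnn-injective : ∀ {s t} → rightAnn s ≡ rightAnn t → s ≡ t
    rightAnn-injective {s} {t} eq = trans (sym (*-identityˡ s)) (trans (cong m12 eq) (*-identityˡ t))

    leftAnn-injective : ∀ {s t} → leftAnn s ≡ leftAnn t → s ≡ t
    leftAnn-injective {s} {t} eq = trans (sym (*-identityʳ s)) (trans (cong m12 eq) (*-identityʳ t))

    m12[rightAnn⊗E] : ∀ t → m12 (rightAnn t ⊗ E) ≡ t + b
    m12[rightAnn⊗E] t = begin
      1# * (1# + a * b ⁻¹ * t) * b + 1# * t * (1# - a)  ≡⟨ solve 4 (λ a b v t → con 1ℤ :* (con 1ℤ :+ a :* v :* t) :* b :+ con 1ℤ :* t :* (con 1ℤ :- a) := b :+ t :- a :* t :+ a :* t :* (v :* b)) refl a b (b ⁻¹) t ⟩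
      b + t - a * t + a * t * (b ⁻¹ * b)                ≡⟨ cong (λ u → b + t - a * t + a * t * u) (⁻¹-inverseˡ b b≢0) ⟩
      b + t - a * t + a * t * 1#                        ≡⟨ solve 3 (λ a b t → b :+ t :- a :* t :+ a :* t :* con 1ℤ := t :+ b) refl a b t ⟩
      t + b                                             ∎

    rightAnn[-b]⊗E≡O : rightAnn (- b) ⊗ E ≡ O
    rightAnn[-b]⊗E≡O = trans (cong (rightAnn (- b) ⊗_) E≡outer) (outer⊗outer≡O ker (1# + a * b ⁻¹ * - b , - b) (Emat-column a b) (a , b) (begin
      (1# + a * b ⁻¹ * - b) * 1# + - b * ((1# - a) * b ⁻¹)  ≡⟨ solve 3 (λ a b v → (con 1ℤ :+ a :* v :* (:- b)) :* con 1ℤ :+ (:- b) :* ((con 1ℤ :- a) :* v) := con 1ℤ :- b :* v) refl a b (b ⁻¹) ⟩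
      1# - b * b ⁻¹                                         ≡⟨ cong (λ u → 1# - u) (⁻¹-inverse b b≢0) ⟩
      1# - 1#                                               ≡⟨ -‿inverseʳ 1# ⟩
      0#                                                    ∎))

    rightAnn⊗E≡O⇒ : ∀ t → rightAnn t ⊗ E ≡ O → t ≡ - b
    rightAnn⊗E≡O⇒ t eq = Equivalence.to x+y≡0⇔x≡-y (trans (sym (m12[rightAnn⊗E] t)) (cong m12 eq))

    bothAnnihilator⇔ : ∀ {K} → (RightAnnihilator K × LeftAnnihilator K) ⇔ K ≡ rightAnn (- b)
    bothAnnihilator⇔ {K} = mk⇔ to from
      where
      to : RightAnnihilator K × LeftAnnihilator K → K ≡ rightAnn (- b)
      to (K-right , _ , K⊗E≡O) =
        let t , K≡rightAnn[t] = Equivalence.to (rightAnnihilator⇔ {K}) K-right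
        in trans K≡rightAnn[t] (cong rightAnn (rightAnn⊗E≡O⇒ t (subst (λ M → M ⊗ E ≡ O) K≡rightAnn[t] K⊗E≡O)))
      from : K ≡ rightAnn (- b) → RightAnnihilator K × LeftAnnihilator K
      from refl = K-right , proj₁ K-right , rightAnn[-b]⊗E≡O
        where
        K-right : RightAnnihilator (rightAnn (- b))
        K-right = Equivalence.from (rightAnnihilator⇔ {rightAnn (- b)}) (- b , refl)

    E⊗E≢O : E ⊗ E ≢ O
    E⊗E≢O = let E⊗E≡E , E≢O , _ = Emat-isVertex b≢0 in λ E⊗E≡O → E≢O (trans (sym E⊗E≡E) E⊗E≡O)

    adjacent⇔ : ∀ {K} → (IsVertex K × Adj E K) ⇔ (RightAnnihilator K ⊎ LeftAnnihilator K)
    adjacent⇔ {K} = mk⇔ to from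
      where
      to : IsVertex K × Adj E K → RightAnnihilator K ⊎ LeftAnnihilator K
      to (K-vertex , _ , inj₁ E⊗K≡O) = inj₁ (K-vertex , E⊗K≡O)
      to (K-vertex , _ , inj₂ K⊗E≡O) = inj₂ (K-vertex , K⊗E≡O)
      from : RightAnnihilator K ⊎ LeftAnnihilator K → IsVertex K × Adj E K
      from (inj₁ (K-vertex , E⊗K≡O)) = K-vertex , (λ { refl → E⊗E≢O E⊗K≡O }) , inj₁ E⊗K≡O
      from (inj₂ (K-vertex , K⊗E≡O)) = K-vertex , (λ { refl → E⊗E≢O K⊗E≡O }) , inj₂ K⊗E≡O

    deg-Emat : deg (Emat a b) ≡ 2 *ℕ size ∸ 1
    deg-Emat = begin
      deg E                          ≡⟨ cong length (filter-≐ (λ K → vertex? K ×-dec adj? E K) either? (Equivalence.to adjacent⇔ , Equivalence.from adjacent⇔) allMats) ⟩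
      #either                        ≡⟨ ℕ.m+n∸n≡m #either 1 ⟨
      #either ℕ.+ 1 ∸ 1              ≡⟨ cong (λ n → #either ℕ.+ n ∸ 1) #both≡1 ⟨
      #either ℕ.+ #both ∸ 1          ≡⟨ cong (_∸ 1) (length-filter-⊎+length-filter-× rightAnnihilator? leftAnnihilator? allMats) ⟩
      #right ℕ.+ #left ∸ 1           ≡⟨ cong₂ (λ m n → m ℕ.+ n ∸ 1) #right≡size #left≡size ⟩
      size ℕ.+ size ∸ 1              ≡⟨ cong (λ n → size ℕ.+ n ∸ 1) (ℕ.+-identityʳ size) ⟨
      2 *ℕ size ∸ 1                  ∎
      where
      either? : Decidable (λ K → RightAnnihilator K ⊎ LeftAnnihilator K)
      either? = λ K → rightAnnihilator? K ⊎-dec leftAnnihilator? K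
      both? : Decidable (λ K → RightAnnihilator K × LeftAnnihilator K)
      both? = λ K → rightAnnihilator? K ×-dec leftAnnihilator? K
      #either #both #right #left : ℕ
      #either = length (filter either? allMats)
      #both = length (filter both? allMats)
      #right = length (filter rightAnnihilator? allMats)
      #left = length (filter leftAnnihilator? allMats)
      #right≡size : #right ≡ size
      #right≡size = length-filter-allMats≡size rightAnnihilator? rightAnn rightAnn-injective rightAnnihilator⇔
      #left≡size : #left ≡ size
      #left≡size = length-filter-allMats≡size leftAnnihilator? leftAnn leftAnn-injective leftAnnihilator⇔
      #both≡1 : #both ≡ 1
      #both≡1 = length-filter≡length both? allMats-unique allMats-complete (All.[] AllPairs.∷ AllPairs.[])
        (mk⇔ (λ both → here (Equivalence.to bothAnnihilator⇔ both)) (λ { (here K≡) → Equivalence.from bothAnnihilator⇔ K≡ ; (there ()) }))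

lemma3p5 : (F : FiniteField) → let open M2 F in
    ∀ a a₁ a₂ b b₁ b₂ →
    a ≢ 0# → a ≢ 1# → a₁ ≢ 0# → a₁ ≢ 1# → a₂ ≢ 0# → a₂ ≢ 1# →
    b ≢ 0# → b₁ ≢ 0# → b₂ ≢ 0# →
    ((Emat a b ⊗ Emat a₁ b₁ ≡ O) ⇔ (b₁ ≡ - ((1# - a₁) * a ⁻¹ * b)))
    × ((Emat a₂ b₂ ⊗ Emat a b ≡ O) ⇔ (b₂ ≡ - (a₂ * (1# - a) ⁻¹ * b)))
    × (deg (Emat a b) ≡ 2 *ℕ size ∸ 1)
lemma3p5 F a a₁ a₂ b b₁ b₂ a≢0 a≢1 _ _ _ _ b≢0 b₁≢0 b₂≢0 =
  Emat⊗Emat≡O⇔b′≡ F a≢0 b≢0 b₁≢0 ,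
  Emat⊗Emat≡O⇔b≡ F (1-x≢0 F a≢1) b₂≢0 b≢0 ,
  Degree.deg-Emat F b≢0
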